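{- Let $p$ be an odd prime, $q$ a power of $p$, $d$ a positive integer with $2d\mid q-1$, and $I\subset\{0,\dots,2d-1\}$ with $|I|=d$. Let $X=PP(q,2d,I)$ and let $PP(q,2d',I')$ be its minimal representation. Then for an integer $k$, $I=I+k$ if and only if $k$ is a multiple of $2d'$, where $I+k=\{j+k \bmod 2d: j\in I\}$.
   Context: $g$ is a fixed primitive root of $\mathbb{F}_q$; the $2d$-th cyclotomic classes are $C_j=g^j\langle g^{2d}\rangle$ (indices mod $2d$). For $I=\{m_1,\dots,m_d\}$, $PP(q,2d,I)$ is the Cayley graph $\mathrm{Cay}(\mathbb{F}_q^+,D)$ with $D=\bigcup_{j=1}^d C_{m_j}$. A representation $PP(q,2d',I')$ of $X$ (meaning $d'\mid d$, $I'\subset\{0,\dots,2d'-1\}$, $|I'|=d'$, same connection set) is minimal if there is no $d''\mid d'$ with $d''<d'$ and $I''\subset\{0,\dots,2d''-1\}$ with $X=PP(q,2d'',I'')$; the minimal representation is unique. -}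

module Defs where

open import Level using (0ℓ)
open import Algebra.Bundles using (CommutativeRing)
open import Data.Nat as ℕ using (ℕ; suc; _<_; _∸_)
open import Data.Nat.Divisibility as ℕD using ()
open import Data.Nat.Primality using (Prime)
open import Data.Integer as ℤ using (ℤ; +_)
open import Data.Integer.Divisibility as ℤD using ()
open import Data.Fin using (Fin; toℕ)
open import Data.Fin.Subset using (Subset; _∈_; ∣_∣)
open import Data.Product using (Σ; ∃; ∃-syntax; _×_; _,_)
open import Relation.Nullary using (¬_)
open import Relation.Binary.PropositionalEquality using (_≡_)
open import Function.Bundles using (_⇔_)

record IsFiniteField (R : CommutativeRing 0ℓ 0ℓ) (q : ℕ) : Set where
  open CommutativeRing R
  field
    nontrivial : ¬ (1# ≈ 0#)
    inverse    : ∀ x → ¬ (x ≈ 0#) → ∃[ y ] (x * y ≈ 1#)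
    enum       : Fin q → Carrier
    enum-surj  : ∀ x → ∃[ i ] (enum i ≈ x)
    enum-inj   : ∀ i j → enum i ≈ enum j → i ≡ j

module _ (R : CommutativeRing 0ℓ 0ℓ) where
  open CommutativeRing R
  open import Algebra.Properties.Semiring.Exp semiring using (_^_)

  IsPrimitiveRoot : ℕ → Carrier → Set
  IsPrimitiveRoot q g =
    (g ^ (q ∸ 1) ≈ 1#) × (∀ m → 0 < m → m < q ∸ 1 → ¬ (g ^ m ≈ 1#))

  -- Connection set D of PP(q,2e,J) = union over j ∈ J of the cyclotomic
  -- classes C_j = g^j ⟨g^{2e}⟩ = { g^(j + 2e t) : t ∈ ℕ }.
  InConnSet : Carrier → (e : ℕ) → Subset (2 ℕ.* e) → Carrier → Set
  InConnSet g e J x = ∃[ j ] (j ∈ J × ∃[ t ] (x ≈ g ^ (toℕ j ℕ.+ (2 ℕ.* e) ℕ.* t)))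

  -- PP(q,2e,J) and PP(q,2e',J') are the same graph: same connection set.
  SamePP : Carrier → (e : ℕ) → Subset (2 ℕ.* e) → (e' : ℕ) → Subset (2 ℕ.* e') → Set
  SamePP g e J e' J' = ∀ x → InConnSet g e J x ⇔ InConnSet g e' J' x

  IsRepresentation : Carrier → (d : ℕ) → Subset (2 ℕ.* d) → (d' : ℕ) → Subset (2 ℕ.* d') → Set
  IsRepresentation g d I d' I' = (d' ℕD.∣ d) × (∣ I' ∣ ≡ d') × SamePP g d' I' d I

  IsMinimalRepresentation : Carrier → (d : ℕ) → Subset (2 ℕ.* d) → (d' : ℕ) → Subset (2 ℕ.* d') → Set
  IsMinimalRepresentation g d I d' I' =
    IsRepresentation g d I d' I' ×
    (∀ d'' (I'' : Subset (2 ℕ.* d'')) → d'' ℕD.∣ d' → d'' < d' →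
       ¬ (IsRepresentation g d I d'' I''))

_∈Shift_by_ : {n : ℕ} → Fin n → Subset n → ℤ → Set
_∈Shift_by_ {n} m I k =
  ∃[ j ] (j ∈ I × ((+ n) ℤD.∣ ((+ toℕ m) ℤ.- ((+ toℕ j) ℤ.+ k))))

ShiftInvariant : {n : ℕ} → Subset n → ℤ → Set
ShiftInvariant I k = ∀ m → (m ∈ I) ⇔ (m ∈Shift I by k)

{-# OPTIONS --safe #-}
-- Write the connection set of PP(q,2e,J) in exponents: g ^ m lies in it iff χ J m is true, where
-- χ J is the 2e-periodic extension of the indicator of J. Two representations therefore give the
-- same graph iff their sequences χ agree, and I = I + k iff s ≡ -k (mod 2d) is a period of χ I;
-- so the claim is that the periods of χ I are exactly the multiples of 2d'. Periods are closed
-- under gcd, so it suffices that a period P dividing 2d' equals 2d'. Since a window of length 2d'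
-- contains d' true values, a window of length P contains P/2 of them; that window is then a
-- representation PP(q,P,·) with P/2 ∣ d', and minimality forces P = 2d'.
module Submission where

open import Level using (0ℓ)
open import Algebra.Bundles using (CommutativeRing)
import Algebra.Properties.Semiring.Exp as Exp
open import Data.Bool.Base using (Bool; true; false; if_then_else_)
open import Data.Nat.Base as ℕ
  using (ℕ; zero; suc; _+_; _*_; _∸_; _<_; _≤_; z<s; NonZero; >-nonZero; ≢-nonZero⁻¹; _%_; _/_)
open import Data.Nat.Properties
  using ( +-identityʳ; +-assoc; +-comm; *-comm; *-suc; *-cancelˡ-≡; *-cancelˡ-≤
        ; *-commutativeSemigroup; m*n≢0; ≤-total; ≤-<-connex; ≤-trans; ≤-<-trans; <⇒≤; <⇒≱; ≤-antisym; ≮⇒≥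
        ; m+[n∸m]≡n; m+n∸m≡n; m∸n+n≡m; m∸n≤m; m<n⇒0<n∸m )
open import Data.Nat.DivMod
  using ( _mod_; m≡m%n+[m/n]*n; m%n<n; m%n≤m; m<n⇒m%n≡m; [m+n]%n≡m%n; m%n%n≡m%n
        ; %-distribˡ-+; %-remove-+ʳ; m∣n⇒o%n%m≡o%m )
open import Data.Nat.Divisibility as ℕD
  using (_∣_; divides; _∣0; ∣-trans; ∣⇒≤; 0∣⇒≡0; m∣m*n; quotient≢0; *-monoʳ-∣; *-cancelˡ-∣)
open import Data.Nat.GCD using (gcd; gcd-GCD; gcd[m,n]∣m; gcd[m,n]∣n; module Bézout)
open import Data.Nat.Primality using (Prime)
open import Data.Integer.Base as ℤ using (ℤ; +_; -[1+_])
open import Data.Integer.Properties using (m-n≡m⊖n; ⊖-≥; ∣⊖∣-<; n⊖n≡0)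
import Data.Integer.Divisibility as ℤD
import Data.Integer.Divisibility.Signed as Signed
open import Data.Integer.Tactic.RingSolver using (solve-∀)
open import Data.Fin.Base as Fin using (Fin; toℕ)
open import Data.Fin.Properties using (toℕ-fromℕ<; toℕ-injective; toℕ<n)
open import Data.Fin.Subset using (Subset; _∈_; ∣_∣)
open import Data.Vec.Base using (lookup; tabulate)
open import Data.Vec.Properties
  using (lookup∘tabulate; tabulate∘lookup; tabulate-cong; []=⇒lookup; lookup⇒[]=)
open import Data.Product.Base using (∃-syntax; _,_; proj₁; proj₂)
open import Data.Sum.Base using (inj₁; inj₂)
open import Data.Empty using (⊥-elim)
open import Function.Base using (_∘_)
open import Function.Bundles using (_⇔_; mk⇔; Equivalence)
open import Function.Properties.Equivalence using (⇔-setoid)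
open import Relation.Nullary using (¬_; contradiction)
open import Relation.Binary.PropositionalEquality
  using (_≡_; _≢_; refl; sym; trans; cong; cong₂; subst; _≗_; module ≡-Reasoning)
import Relation.Binary.Reasoning.Setoid as SetoidReasoning
open import Algebra.Properties.CommutativeSemigroup *-commutativeSemigroup using (x∙yz≈y∙xz)
open import Defs

module ⇔-Reasoning = SetoidReasoning (⇔-setoid 0ℓ)

≡true-injective : ∀ {b c : Bool} → b ≡ true ⇔ c ≡ true → b ≡ c
≡true-injective {true}          b⇔c = sym (Equivalence.to b⇔c refl)
≡true-injective {false} {true}  b⇔c = Equivalence.from b⇔c refl
≡true-injective {false} {false} _   = refl

nonZero-∣ : ∀ {m n} .{{_ : NonZero n}} → m ∣ n → NonZero m
nonZero-∣ {zero}  {n} 0∣n = contradiction (0∣⇒≡0 0∣n) (≢-nonZero⁻¹ n)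
nonZero-∣ {suc m} _       = _

%-≡-divisor : ∀ {m n a b} .{{_ : NonZero m}} .{{_ : NonZero n}} →
              m ∣ n → a % n ≡ b % n → a % m ≡ b % m
%-≡-divisor {m} {n} {a} {b} m∣n eq =
  trans (sym (m∣n⇒o%n%m≡o%m m n a m∣n)) (trans (cong (_% m) eq) (m∣n⇒o%n%m≡o%m m n b m∣n))

Periodic : (ℕ → Bool) → ℕ → Set
Periodic f p = ∀ m → f (m + p) ≡ f m

module _ {f : ℕ → Bool} where

  periodic-* : ∀ {p} k → Periodic f p → Periodic f (k * p)
  periodic-* zero    per m = cong f (+-identityʳ m)
  periodic-* {p} (suc k) per m = begin
    f (m + (p + k * p))  ≡⟨ cong f (+-assoc m p (k * p)) ⟨
    f (m + p + k * p)    ≡⟨ periodic-* k per (m + p) ⟩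
    f (m + p)            ≡⟨ per m ⟩
    f m                  ∎
    where open ≡-Reasoning

  periodic-∣ : ∀ {p q} → p ∣ q → Periodic f p → Periodic f q
  periodic-∣ (divides k refl) = periodic-* k

  periodic-% : ∀ {p} .{{_ : NonZero p}} → Periodic f p → ∀ m → f m ≡ f (m % p)
  periodic-% {p} per m =
    trans (cong f (m≡m%n+[m/n]*n m p)) (periodic-* (m / p) per (m % p))

  periodic-difference : ∀ {a b h} x y → Periodic f a → Periodic f b →
                        h + y * b ≡ x * a → Periodic f h
  periodic-difference {h = h} x y per-a per-b eq m = begin
    f (m + h)          ≡⟨ periodic-* y per-b (m + h) ⟨
    f (m + h + y * _)  ≡⟨ cong f (trans (+-assoc m h _) (cong (_+_ m) eq)) ⟩
    f (m + x * _)      ≡⟨ periodic-* x per-a m ⟩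
    f m                ∎
    where open ≡-Reasoning

  periodic-gcd : ∀ {p q} → Periodic f p → Periodic f q → Periodic f (gcd p q)
  periodic-gcd {p} {q} per-p per-q with Bézout.identity (gcd-GCD p q)
  ... | Bézout.+- x y eq = periodic-difference x y per-p per-q eq
  ... | Bézout.-+ x y eq = periodic-difference y x per-q per-p eq

count : (ℕ → Bool) → ℕ → ℕ
count f zero    = zero
count f (suc n) = if f 0 then suc (count (f ∘ suc) n) else count (f ∘ suc) n

count-cong : ∀ {f g} → f ≗ g → ∀ n → count f n ≡ count g n
count-cong f≗g zero    = refl
count-cong f≗g (suc n) =
  cong₂ (λ b c → if b then suc c else c) (f≗g 0) (count-cong (f≗g ∘ suc) n)

count-+ : ∀ f a b → count f (a + b) ≡ count f a + count (f ∘ (_+_ a)) b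
count-+ f zero    b = refl
count-+ f (suc a) b with f 0
... | true  = cong suc (count-+ (f ∘ suc) a b)
... | false = count-+ (f ∘ suc) a b

count-periodic : ∀ {f p} → Periodic f p → ∀ k → count f (k * p) ≡ k * count f p
count-periodic per zero = refl
count-periodic {f} {p} per (suc k) = begin
  count f (p + k * p)                      ≡⟨ count-+ f p (k * p) ⟩
  count f p + count (f ∘ (_+_ p)) (k * p)  ≡⟨ cong (_+_ (count f p)) (count-cong shifted (k * p)) ⟩
  count f p + count f (k * p)              ≡⟨ cong (_+_ (count f p)) (count-periodic per k) ⟩
  count f p + k * count f p                ∎
  where
  open ≡-Reasoning
  shifted : f ∘ (_+_ p) ≗ f
  shifted i = trans (cong f (+-comm p i)) (per i)

period≡2*count : ∀ {f P e} .{{_ : NonZero (2 * e)}} → Periodic f P → P ∣ 2 * e →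
                 count f (2 * e) ≡ e → P ≡ 2 * count f P
period≡2*count {f} {P} {e} per P∣2e@(divides a 2e≡aP) count≡e =
  *-cancelˡ-≡ P (2 * c) a (begin
    a * P        ≡⟨ 2e≡aP ⟨
    2 * e        ≡⟨ cong (2 *_) e≡ac ⟩
    2 * (a * c)  ≡⟨ x∙yz≈y∙xz 2 a c ⟩
    a * (2 * c)  ∎)
  where
  open ≡-Reasoning
  instance _ = quotient≢0 P∣2e
  c = count f P
  e≡ac : e ≡ a * c
  e≡ac = trans (sym count≡e) (trans (cong (count f) 2e≡aP) (count-periodic per a))

module _ {N} .{{_ : NonZero N}} where

  toℕ-mod : ∀ m → toℕ (m mod N) ≡ m % N
  toℕ-mod m = toℕ-fromℕ< (m%n<n m N)

  mod-cong : ∀ {a b} → a % N ≡ b % N → a mod N ≡ b mod N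
  mod-cong {a} {b} eq = toℕ-injective (trans (toℕ-mod a) (trans eq (sym (toℕ-mod b))))

  mod-toℕ : ∀ (i : Fin N) → toℕ i mod N ≡ i
  mod-toℕ i = toℕ-injective (trans (toℕ-mod (toℕ i)) (m<n⇒m%n≡m (toℕ<n i)))

  mod-+ˡ : ∀ a b → (toℕ (a mod N) + b) mod N ≡ (a + b) mod N
  mod-+ˡ a b = mod-cong (begin
    (toℕ (a mod N) + b) % N  ≡⟨ cong (λ x → (x + b) % N) (toℕ-mod a) ⟩
    (a % N + b) % N          ≡⟨ %-distribˡ-+ (a % N) b N ⟩
    (a % N % N + b % N) % N  ≡⟨ cong (λ x → (x + b % N) % N) (m%n%n≡m%n a N) ⟩
    (a % N + b % N) % N      ≡⟨ %-distribˡ-+ a b N ⟨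
    (a + b) % N              ∎)
    where open ≡-Reasoning

  mod≡⇔∣ : ∀ a (j : Fin N) → a mod N ≡ j ⇔ (+ N) ℤD.∣ (+ a ℤ.- + toℕ j)
  mod≡⇔∣ a j with ≤-<-connex (toℕ j) a
  ... | inj₁ j≤a = mk⇔
    (λ a-mod≡j → subst (N ∣_) (sym ∣a-j∣≡a∸j) (divides (a / N) (a∸j≡[a/N]*N a-mod≡j)))
    (λ N∣a-j → trans (mod-cong (a%N≡j%N (subst (N ∣_) ∣a-j∣≡a∸j N∣a-j))) (mod-toℕ j))
    where
    ∣a-j∣≡a∸j : ℤ.∣ + a ℤ.- + toℕ j ∣ ≡ a ∸ toℕ j
    ∣a-j∣≡a∸j = cong ℤ.∣_∣ (trans (m-n≡m⊖n a (toℕ j)) (⊖-≥ j≤a))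
    a∸j≡[a/N]*N : a mod N ≡ j → a ∸ toℕ j ≡ (a / N) * N
    a∸j≡[a/N]*N refl = begin
      a ∸ toℕ (a mod N)            ≡⟨ cong (a ∸_) (toℕ-mod a) ⟩
      a ∸ a % N                    ≡⟨ cong (_∸ a % N) (m≡m%n+[m/n]*n a N) ⟩
      a % N + (a / N) * N ∸ a % N  ≡⟨ m+n∸m≡n (a % N) _ ⟩
      (a / N) * N                  ∎
      where open ≡-Reasoning
    a%N≡j%N : N ∣ a ∸ toℕ j → a % N ≡ toℕ j % N
    a%N≡j%N N∣a∸j = trans (cong (_% N) (sym (m+[n∸m]≡n j≤a))) (%-remove-+ʳ (toℕ j) N∣a∸j)
  ... | inj₂ a<j = mk⇔ (⊥-elim ∘ a-mod≢j) (⊥-elim ∘ N∤a-j)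
    where
    a-mod≢j : a mod N ≢ j
    a-mod≢j a-mod≡j =
      <⇒≱ a<j (subst (_≤ a) (trans (sym (toℕ-mod a)) (cong toℕ a-mod≡j)) (m%n≤m a N))
    N∤a-j : ¬ (+ N) ℤD.∣ (+ a ℤ.- + toℕ j)
    N∤a-j N∣a-j =
      <⇒≱ (toℕ<n j) (≤-trans (∣⇒≤ {{>-nonZero (m<n⇒0<n∸m a<j)}} N∣j∸a) (m∸n≤m (toℕ j) a))
      where
      N∣j∸a : N ∣ toℕ j ∸ a
      N∣j∸a = subst (N ∣_) (trans (cong ℤ.∣_∣ (m-n≡m⊖n a (toℕ j))) (∣⊖∣-< a<j)) N∣a-j

χ : ∀ {N} .{{_ : NonZero N}} → Subset N → ℕ → Bool
χ {N} J m = lookup J (m mod N)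

module _ {N} .{{_ : NonZero N}} where

  χ≡true⇔∈ : ∀ {J : Subset N} {m} → χ J m ≡ true ⇔ m mod N ∈ J
  χ≡true⇔∈ {J} {m} = mk⇔ (lookup⇒[]= (m mod N) J) []=⇒lookup

  χ-toℕ : ∀ (J : Subset N) i → χ J (toℕ i) ≡ lookup J i
  χ-toℕ J i = cong (lookup J) (mod-toℕ i)

  χ-periodic : ∀ (J : Subset N) → Periodic (χ J) N
  χ-periodic J m = cong (lookup J) (mod-cong ([m+n]%n≡m%n m N))

window : ∀ P → (ℕ → Bool) → Subset P
window P f = tabulate (f ∘ toℕ)

∣window∣ : ∀ P f → ∣ window P f ∣ ≡ count f P
∣window∣ zero    f = refl
∣window∣ (suc P) f with f 0
... | true  = cong suc (∣window∣ P (f ∘ suc))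
... | false = ∣window∣ P (f ∘ suc)

χ-window : ∀ {P f} .{{_ : NonZero P}} → Periodic f P → χ (window P f) ≗ f
χ-window {P} {f} per m = begin
  lookup (window P f) (m mod P)  ≡⟨ lookup∘tabulate (f ∘ toℕ) (m mod P) ⟩
  f (toℕ (m mod P))              ≡⟨ cong f (toℕ-mod m) ⟩
  f (m % P)                      ≡⟨ periodic-% per m ⟨
  f m                            ∎
  where open ≡-Reasoning

∣∣≡count-χ : ∀ {N} .{{_ : NonZero N}} (J : Subset N) → ∣ J ∣ ≡ count (χ J) N
∣∣≡count-χ {N} J = begin
  ∣ J ∣                    ≡⟨ cong ∣_∣ (tabulate∘lookup J) ⟨
  ∣ tabulate (lookup J) ∣  ≡⟨ cong ∣_∣ (tabulate-cong (sym ∘ χ-toℕ J)) ⟩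
  ∣ window N (χ J) ∣       ≡⟨ ∣window∣ N (χ J) ⟩
  count (χ J) N            ∎
  where open ≡-Reasoning

∣-+-multiple : ∀ i u v → i ℤD.∣ u → i ℤD.∣ v ⇔ i ℤD.∣ (v ℤ.+ u)
∣-+-multiple i u v i∣u = mk⇔
  (λ i∣v → Signed.∣⇒∣ᵤ {i} {v ℤ.+ u}
    (Signed.∣m∣n⇒∣m+n (Signed.∣ᵤ⇒∣ {i} {v} i∣v) i∣ˢu))
  (λ i∣v+u → Signed.∣⇒∣ᵤ {i} {v}
    (Signed.∣m+n∣n⇒∣m {i} {v} {u} (Signed.∣ᵤ⇒∣ {i} {v ℤ.+ u} i∣v+u) i∣ˢu))
  where i∣ˢu = Signed.∣ᵤ⇒∣ {i} {u} i∣u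

∃-negation-mod : ∀ N .{{_ : NonZero N}} k → ∃[ s ] ((+ N) ℤD.∣ (+ s ℤ.+ k))
∃-negation-mod (suc N) (+ n)    =
  n * N , divides n (trans (+-comm (n * N) n) (sym (*-suc n N)))
∃-negation-mod (suc N) -[1+ n ] =
  suc n , subst (suc N ∣_) (cong ℤ.∣_∣ (sym (n⊖n≡0 (suc n)))) (suc N ∣0)

∣k⇔∣s : ∀ {D N} s k → D ∣ N → (+ N) ℤD.∣ (+ s ℤ.+ k) → (+ D) ℤD.∣ k ⇔ D ∣ s
∣k⇔∣s {D} s k D∣N N∣s+k = mk⇔
  (λ D∣k → Signed.∣⇒∣ᵤ {+ D} {+ s}
    (Signed.∣m+n∣n⇒∣m {+ D} {+ s} {k} D∣s+k (Signed.∣ᵤ⇒∣ {+ D} {k} D∣k)))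
  (λ D∣s → Signed.∣⇒∣ᵤ {+ D} {k}
    (Signed.∣m+n∣m⇒∣n {+ D} {+ s} {k} D∣s+k (Signed.∣ᵤ⇒∣ {+ D} {+ s} D∣s)))
  where D∣s+k = Signed.∣ᵤ⇒∣ {+ D} {+ s ℤ.+ k} (∣-trans D∣N N∣s+k)

module _ {N} .{{_ : NonZero N}} (s : ℕ) (k : ℤ) (N∣s+k : (+ N) ℤD.∣ (+ s ℤ.+ k))
         (I : Subset N) where
  open ⇔-Reasoning

  ∈Shift⇔χ : ∀ m → m ∈Shift I by k ⇔ χ I (toℕ m + s) ≡ true
  ∈Shift⇔χ m = mk⇔
    (λ (j , j∈I , N∣) →
      Equivalence.from χ≡true⇔∈ (subst (_∈ I) (sym (Equivalence.to (∣⇔mod≡ j) N∣)) j∈I))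
    (λ χ≡true →
      (toℕ m + s) mod N , Equivalence.to χ≡true⇔∈ χ≡true , Equivalence.from (∣⇔mod≡ _) refl)
    where
    regroup : ∀ x y z w → (x ℤ.- (y ℤ.+ w)) ℤ.+ (z ℤ.+ w) ≡ (x ℤ.+ z) ℤ.- y
    regroup = solve-∀
    ∣⇔mod≡ : ∀ j → (+ N) ℤD.∣ (+ toℕ m ℤ.- (+ toℕ j ℤ.+ k)) ⇔ (toℕ m + s) mod N ≡ j
    ∣⇔mod≡ j = begin
      (+ N) ℤD.∣ (+ toℕ m ℤ.- (+ toℕ j ℤ.+ k))
        ≈⟨ ∣-+-multiple (+ N) (+ s ℤ.+ k) (+ toℕ m ℤ.- (+ toℕ j ℤ.+ k)) N∣s+k ⟩
      (+ N) ℤD.∣ ((+ toℕ m ℤ.- (+ toℕ j ℤ.+ k)) ℤ.+ (+ s ℤ.+ k))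
        ≡⟨ cong ((+ N) ℤD.∣_) (regroup (+ toℕ m) (+ toℕ j) (+ s) k) ⟩
      (+ N) ℤD.∣ (+ (toℕ m + s) ℤ.- + toℕ j)
        ≈⟨ mod≡⇔∣ (toℕ m + s) j ⟨
      (toℕ m + s) mod N ≡ j
        ∎

  shiftInvariant⇔periodic : ShiftInvariant I k ⇔ Periodic (χ I) s
  shiftInvariant⇔periodic = mk⇔ invariant⇒periodic periodic⇒invariant
    where
    invariant⇒periodic : ShiftInvariant I k → Periodic (χ I) s
    invariant⇒periodic invariant a = sym (≡true-injective (begin
      χ I a ≡ true                    ≈⟨ χ≡true⇔∈ ⟩
      a mod N ∈ I                     ≈⟨ invariant (a mod N) ⟩
      (a mod N) ∈Shift I by k         ≈⟨ ∈Shift⇔χ (a mod N) ⟩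
      χ I (toℕ (a mod N) + s) ≡ true  ≡⟨ cong (λ x → lookup I x ≡ true) (mod-+ˡ a s) ⟩
      χ I (a + s) ≡ true              ∎))

    periodic⇒invariant : Periodic (χ I) s → ShiftInvariant I k
    periodic⇒invariant periodic m = begin
      m ∈ I                   ≡⟨ cong (_∈ I) (mod-toℕ m) ⟨
      toℕ m mod N ∈ I         ≈⟨ χ≡true⇔∈ ⟨
      χ I (toℕ m) ≡ true      ≡⟨ cong (_≡ true) (periodic (toℕ m)) ⟨
      χ I (toℕ m + s) ≡ true  ≈⟨ ∈Shift⇔χ m ⟨
      m ∈Shift I by k         ∎

q∸1-nonZero : ∀ {F q} → IsFiniteField F q → NonZero (q ∸ 1)
q∸1-nonZero {F} {zero} finite with IsFiniteField.enum-surj finite (CommutativeRing.1# F)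
... | () , _
q∸1-nonZero {F} {suc zero} finite
  with IsFiniteField.enum-surj finite (CommutativeRing.1# F)
     | IsFiniteField.enum-surj finite (CommutativeRing.0# F)
... | Fin.zero , e₀≈1 | Fin.zero , e₀≈0 = contradiction
  (CommutativeRing.trans F (CommutativeRing.sym F e₀≈1) e₀≈0) (IsFiniteField.nontrivial finite)
q∸1-nonZero {F} {suc (suc q)} _ = _

module PrimitiveRootPowers (R : CommutativeRing 0ℓ 0ℓ) (q : ℕ) (g : CommutativeRing.Carrier R)
                           (prim : IsPrimitiveRoot R q g) .{{_ : NonZero (q ∸ 1)}} where
  open CommutativeRing R
    using (_≈_; 1#; semiring; setoid; *-assoc; *-congˡ; *-congʳ; *-identityˡ; *-identityʳ)
    renaming (_*_ to _·_; refl to ≈-refl; sym to ≈-sym; trans to ≈-trans)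
  open Exp semiring using (_^_; ^-homo-*; ^-congʳ)
  module ≈-Reasoning = SetoidReasoning setoid

  private
    n : ℕ
    n = q ∸ 1

    g^n≈1 : g ^ n ≈ 1#
    g^n≈1 = proj₁ prim

  ^-+-multiple : ∀ m k → g ^ (m + k * n) ≈ g ^ m
  ^-+-multiple m zero = ^-congʳ g (+-identityʳ m)
  ^-+-multiple m (suc k) = begin
    g ^ (m + (n + k * n))      ≈⟨ ^-congʳ g (cong (_+_ m) (+-comm n (k * n))) ⟩
    g ^ (m + (k * n + n))      ≈⟨ ^-congʳ g (+-assoc m (k * n) n) ⟨
    g ^ (m + k * n + n)        ≈⟨ ^-homo-* g (m + k * n) n ⟩
    g ^ (m + k * n) · g ^ n    ≈⟨ *-congˡ g^n≈1 ⟩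
    g ^ (m + k * n) · 1#       ≈⟨ *-identityʳ _ ⟩
    g ^ (m + k * n)            ≈⟨ ^-+-multiple m k ⟩
    g ^ m                      ∎
    where open ≈-Reasoning

  ^-% : ∀ a → g ^ a ≈ g ^ (a % n)
  ^-% a = begin
    g ^ a                      ≈⟨ ^-congʳ g (m≡m%n+[m/n]*n a n) ⟩
    g ^ (a % n + (a / n) * n)  ≈⟨ ^-+-multiple (a % n) (a / n) ⟩
    g ^ (a % n)                ∎
    where open ≈-Reasoning

  ^-cancelˡ : ∀ {a x y} → a ≤ n → g ^ a · x ≈ g ^ a · y → x ≈ y
  ^-cancelˡ {a} {x} {y} a≤n eq = begin
    x                          ≈⟨ *-identityˡ x ⟨
    1# · x                     ≈⟨ *-congʳ inverse ⟨
    (g ^ (n ∸ a) · g ^ a) · x  ≈⟨ *-assoc _ _ x ⟩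
    g ^ (n ∸ a) · (g ^ a · x)  ≈⟨ *-congˡ eq ⟩
    g ^ (n ∸ a) · (g ^ a · y)  ≈⟨ *-assoc _ _ y ⟨
    (g ^ (n ∸ a) · g ^ a) · y  ≈⟨ *-congʳ inverse ⟩
    1# · y                     ≈⟨ *-identityˡ y ⟩
    y                          ∎
    where
    open ≈-Reasoning
    inverse : g ^ (n ∸ a) · g ^ a ≈ 1#
    inverse = ≈-trans (≈-sym (^-homo-* g (n ∸ a) a)) (≈-trans (^-congʳ g (m∸n+n≡m a≤n)) g^n≈1)

  ^≈1⇒≡0 : ∀ {c} → c < n → g ^ c ≈ 1# → c ≡ 0
  ^≈1⇒≡0 {zero}  _   _      = refl
  ^≈1⇒≡0 {suc c} c<n g^c≈1 = contradiction g^c≈1 (proj₂ prim (suc c) z<s c<n)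

  ^-injective-≤ : ∀ {a b} → a ≤ b → b < n → g ^ a ≈ g ^ b → a ≡ b
  ^-injective-≤ {a} {b} a≤b b<n g^a≈g^b =
    trans (sym (+-identityʳ a)) (trans (cong (_+_ a) (sym b∸a≡0)) (m+[n∸m]≡n a≤b))
    where
    open ≈-Reasoning
    b∸a≡0 : b ∸ a ≡ 0
    b∸a≡0 = ^≈1⇒≡0 (≤-<-trans (m∸n≤m b a) b<n) (^-cancelˡ (≤-trans a≤b (<⇒≤ b<n)) (begin
      g ^ a · g ^ (b ∸ a)  ≈⟨ ^-homo-* g a (b ∸ a) ⟨
      g ^ (a + (b ∸ a))    ≈⟨ ^-congʳ g (m+[n∸m]≡n a≤b) ⟩
      g ^ b                ≈⟨ g^a≈g^b ⟨
      g ^ a                ≈⟨ *-identityʳ (g ^ a) ⟨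
      g ^ a · 1#           ∎))

  ^-injective : ∀ {a b} → a < n → b < n → g ^ a ≈ g ^ b → a ≡ b
  ^-injective {a} {b} a<n b<n g^a≈g^b with ≤-total a b
  ... | inj₁ a≤b = ^-injective-≤ a≤b b<n g^a≈g^b
  ... | inj₂ b≤a = sym (^-injective-≤ b≤a a<n (≈-sym g^a≈g^b))

  ^≈⇒%≡ : ∀ {a b} → g ^ a ≈ g ^ b → a % n ≡ b % n
  ^≈⇒%≡ {a} {b} g^a≈g^b =
    ^-injective (m%n<n a n) (m%n<n b n) (≈-trans (≈-sym (^-% a)) (≈-trans g^a≈g^b (^-% b)))

  InConnSet-resp : ∀ {e J x y} → x ≈ y → InConnSet R g e J y → InConnSet R g e J x
  InConnSet-resp x≈y (j , j∈J , t , y≈) = j , j∈J , t , ≈-trans x≈y y≈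

  module _ (e : ℕ) .{{_ : NonZero (2 * e)}} (2e∣n : 2 * e ∣ n) {J : Subset (2 * e)} where

    InConnSet-^⇔χ : ∀ m → InConnSet R g e J (g ^ m) ⇔ χ J m ≡ true
    InConnSet-^⇔χ m = mk⇔
      (λ (j , j∈J , t , g^m≈) →
        Equivalence.from χ≡true⇔∈ (subst (_∈ J) (sym (m-mod≡j g^m≈)) j∈J))
      (λ χ≡true →
        m mod (2 * e) , Equivalence.to χ≡true⇔∈ χ≡true , m / (2 * e) , ^-congʳ g m≡)
      where
      m-mod≡j : ∀ {j t} → g ^ m ≈ g ^ (toℕ j + 2 * e * t) → m mod (2 * e) ≡ j
      m-mod≡j {j} {t} g^m≈ = trans
        (mod-cong (trans (%-≡-divisor 2e∣n (^≈⇒%≡ g^m≈)) (%-remove-+ʳ (toℕ j) (m∣m*n t))))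
        (mod-toℕ j)
      m≡ : m ≡ toℕ (m mod (2 * e)) + 2 * e * (m / (2 * e))
      m≡ = trans (m≡m%n+[m/n]*n m (2 * e))
                 (cong₂ _+_ (sym (toℕ-mod m)) (*-comm (m / (2 * e)) (2 * e)))

  χ≗⇒InConnSet-⊆ : ∀ {e e'} .{{_ : NonZero (2 * e)}} .{{_ : NonZero (2 * e')}} →
                   2 * e ∣ n → 2 * e' ∣ n → ∀ {J : Subset (2 * e)} {J' : Subset (2 * e')} →
                   χ J ≗ χ J' → ∀ {x} → InConnSet R g e J x → InConnSet R g e' J' x
  χ≗⇒InConnSet-⊆ {e} {e'} 2e∣n 2e'∣n χJ≗χJ' (j , j∈J , t , x≈) = InConnSet-resp {e'} x≈
    (Equivalence.from (InConnSet-^⇔χ e' 2e'∣n m)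
      (trans (sym (χJ≗χJ' m)) (Equivalence.to (InConnSet-^⇔χ e 2e∣n m) (j , j∈J , t , ≈-refl))))
    where m = toℕ j + 2 * e * t

  SamePP⇔χ≗ : ∀ e e' .{{_ : NonZero (2 * e)}} .{{_ : NonZero (2 * e')}} →
              2 * e ∣ n → 2 * e' ∣ n → ∀ {J : Subset (2 * e)} {J' : Subset (2 * e')} →
              SamePP R g e J e' J' ⇔ χ J ≗ χ J'
  SamePP⇔χ≗ e e' 2e∣n 2e'∣n {J} {J'} = mk⇔
    (λ same m → ≡true-injective (begin
      χ J m ≡ true                    ≈⟨ InConnSet-^⇔χ e 2e∣n m ⟨
      InConnSet R g e J (g ^ m)       ≈⟨ same (g ^ m) ⟩
      InConnSet R g e' J' (g ^ m)     ≈⟨ InConnSet-^⇔χ e' 2e'∣n m ⟩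
      χ J' m ≡ true                   ∎))
    (λ χJ≗χJ' x → mk⇔ (χ≗⇒InConnSet-⊆ {e} {e'} 2e∣n 2e'∣n χJ≗χJ')
                      (χ≗⇒InConnSet-⊆ {e'} {e} 2e'∣n 2e∣n (sym ∘ χJ≗χJ')))
    where open ⇔-Reasoning

module Representations (F : CommutativeRing 0ℓ 0ℓ) (q : ℕ) (g : CommutativeRing.Carrier F)
                       (prim : IsPrimitiveRoot F q g) .{{_ : NonZero (q ∸ 1)}}
                       (d : ℕ) .{{_ : NonZero (2 * d)}} (2d∣n : 2 * d ∣ q ∸ 1) (I : Subset (2 * d)) where
  open PrimitiveRootPowers F q g prim

  window-representation : ∀ c .{{_ : NonZero (2 * c)}} → Periodic (χ I) (2 * c) → 2 * c ∣ 2 * d →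
                          count (χ I) (2 * c) ≡ c → IsRepresentation F g d I c (window (2 * c) (χ I))
  window-representation c periodic 2c∣2d count≡c =
    *-cancelˡ-∣ 2 2c∣2d ,
    trans (∣window∣ (2 * c) (χ I)) count≡c ,
    Equivalence.from (SamePP⇔χ≗ c d (∣-trans 2c∣2d 2d∣n) 2d∣n) (χ-window periodic)

  module _ {d'} {I' : Subset (2 * d')} (rep : IsRepresentation F g d I d' I') where

    2d'∣2d : 2 * d' ∣ 2 * d
    2d'∣2d = *-monoʳ-∣ 2 (proj₁ rep)

    instance
      2d'-nonZero : NonZero (2 * d')
      2d'-nonZero = nonZero-∣ 2d'∣2d

    χ-representation : χ I' ≗ χ I
    χ-representation =
      Equivalence.to (SamePP⇔χ≗ d' d (∣-trans 2d'∣2d 2d∣n) 2d∣n) (proj₂ (proj₂ rep))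

    periodic-representation : Periodic (χ I) (2 * d')
    periodic-representation m =
      trans (sym (χ-representation (m + 2 * d'))) (trans (χ-periodic I' m) (χ-representation m))

    count-representation : count (χ I) (2 * d') ≡ d'
    count-representation = begin
      count (χ I) (2 * d')   ≡⟨ count-cong χ-representation (2 * d') ⟨
      count (χ I') (2 * d')  ≡⟨ ∣∣≡count-χ I' ⟨
      ∣ I' ∣                 ≡⟨ proj₁ (proj₂ rep) ⟩
      d'                     ∎
      where open ≡-Reasoning

  module _ {d'} {I' : Subset (2 * d')} (minimal : IsMinimalRepresentation F g d I d' I') where

    private
      rep = proj₁ minimal
      instance _ = 2d'-nonZero rep

    period-of-minimal : ∀ P .{{_ : NonZero P}} → Periodic (χ I) P → P ∣ 2 * d' → P ≡ 2 * d'
    period-of-minimal P periodic P∣2d' = trans P≡2c (cong (2 *_) c≡d')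
      where
      c = count (χ I) P
      P≡2c : P ≡ 2 * c
      P≡2c = period≡2*count periodic P∣2d' (count-representation rep)
      2c∣2d' : 2 * c ∣ 2 * d'
      2c∣2d' = subst (_∣ 2 * d') P≡2c P∣2d'
      2c∣2d : 2 * c ∣ 2 * d
      2c∣2d = ∣-trans 2c∣2d' (2d'∣2d rep)
      instance
        2c-nonZero : NonZero (2 * c)
        2c-nonZero = nonZero-∣ 2c∣2d
      c∣d' : c ∣ d'
      c∣d' = *-cancelˡ-∣ 2 2c∣2d'
      window-rep : IsRepresentation F g d I c (window (2 * c) (χ I))
      window-rep = window-representation c (subst (Periodic (χ I)) P≡2c periodic) 2c∣2d
                                         (cong (count (χ I)) (sym P≡2c))
      c≡d' : c ≡ d'
      c≡d' = ≤-antisym (*-cancelˡ-≤ 2 (∣⇒≤ 2c∣2d'))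
                       (≮⇒≥ (λ c<d' → proj₂ minimal c _ c∣d' c<d' window-rep))

    periodic⇔2d'∣ : ∀ s → Periodic (χ I) s ⇔ 2 * d' ∣ s
    periodic⇔2d'∣ s = mk⇔
      (λ periodic → subst (_∣ s) (P≡2d' periodic) (gcd[m,n]∣m s (2 * d')))
      (λ 2d'∣s → periodic-∣ 2d'∣s (periodic-representation rep))
      where
      P≡2d' : Periodic (χ I) s → gcd s (2 * d') ≡ 2 * d'
      P≡2d' periodic = period-of-minimal (gcd s (2 * d')) {{nonZero-∣ (gcd[m,n]∣n s (2 * d'))}}
        (periodic-gcd periodic (periodic-representation rep)) (gcd[m,n]∣n s (2 * d'))

-- Imported only here: in PrimitiveRootPowers, _^_ is exponentiation in the ring.
open import Data.Nat.Base using (_^_)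

lemma2p4 : (p q : ℕ) → Prime p → ¬ (2 ℕD.∣ p) → ∃[ n ] (q ≡ p ^ n) →
    (F : CommutativeRing 0ℓ 0ℓ) → IsFiniteField F q →
    (g : CommutativeRing.Carrier F) → IsPrimitiveRoot F q g →
    (d : ℕ) → 0 < d → (2 ℕ.* d) ℕD.∣ (q ∸ 1) →
    (I : Subset (2 ℕ.* d)) → ∣ I ∣ ≡ d →
    (d' : ℕ) (I' : Subset (2 ℕ.* d')) → IsMinimalRepresentation F g d I d' I' →
    (k : ℤ) → ShiftInvariant I k ⇔ ((+ (2 ℕ.* d')) ℤD.∣ k)
lemma2p4 _ q _ _ _ F finite g prim d 0<d 2d∣n I _ d' I' minimal k = begin
  ShiftInvariant I k   ≈⟨ shiftInvariant⇔periodic s k N∣s+k I ⟩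
  Periodic (χ I) s     ≈⟨ periodic⇔2d'∣ minimal s ⟩
  2 * d' ∣ s           ≈⟨ ∣k⇔∣s s k (2d'∣2d (proj₁ minimal)) N∣s+k ⟨
  (+ (2 * d')) ℤD.∣ k  ∎
  where
  open ⇔-Reasoning
  instance
    _ = q∸1-nonZero finite
    _ = m*n≢0 2 d {{_}} {{>-nonZero 0<d}}
  open Representations F q g prim d 2d∣n I
  s = proj₁ (∃-negation-mod (2 * d) k)
  N∣s+k = proj₂ (∃-negation-mod (2 * d) k)
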